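{- Let $(\mathcal{C},\Omega,\mathfrak{P})$ be a spined category and $Q$ the set of its pseudo-chordal objects. Then $\Omega_n\in Q$ for every $n\in\mathbb{N}$, and for all $A,B\in Q$ and morphisms $f:\Omega_n\to A$, $g:\Omega_n\to B$ we have $\mathfrak{P}(f,g)\in Q$.
   Context: A spined category is a triple $(\mathcal{C},\Omega,\mathfrak{P})$: a category $\mathcal{C}$, a sequence of objects $(\Omega_n)_{n\in\mathbb{N}}$, and an operation $\mathfrak{P}$ assigning to each span $G\xleftarrow{g}\Omega_n\xrightarrow{h}H$ an object $\mathfrak{P}(g,h)$ and morphisms $\mathfrak{P}(g,h)_g:G\to\mathfrak{P}(g,h)$, $\mathfrak{P}(g,h)_h:H\to\mathfrak{P}(g,h)$ with $\mathfrak{P}(g,h)_gg=\mathfrak{P}(g,h)_hh$, such that (SC1) every object has a morphism to some $\Omega_n$; (SC2) for every such span and all $g':G\to G'$, $h':H\to H'$ there is a unique morphism $(g',h'):\mathfrak{P}(g,h)\to\mathfrak{P}(g'g,h'h)$ with $(g',h')\mathfrak{P}(g,h)_g=\mathfrak{P}(g'g,h'h)_{g'g}g'$ and $(g',h')\mathfrak{P}(g,h)_h=\mathfrak{P}(g'g,h'h)_{h'h}h'$. An S-functor is a functor $F$ to the poset $(\mathbb{N},\le)$ with $F(\Omega_n)=n$ and $F(\mathfrak{P}(g,h))=\max\{F(G),F(H)\}$ for every span. An object $X$ is pseudo-chordal if $F(X)=G(X)$ for every two S-functors $F,G$ (so if no S-functor exists, every object is pseudo-chordal). -}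

module Defs where

open import Level using (Level; _⊔_; suc)
open import Data.Nat using (ℕ; _≤_) renaming (_⊔_ to max)
open import Data.Product using (Σ; _×_; _,_)
open import Relation.Binary using (IsEquivalence)
open import Relation.Binary.PropositionalEquality using (_≡_)

record Category (o ℓ e : Level) : Set (suc (o ⊔ ℓ ⊔ e)) where
  infixr 9 _∘_
  infix  4 _≈_
  field
    Obj   : Set o
    Hom   : Obj → Obj → Set ℓ
    _≈_   : ∀ {A B} → Hom A B → Hom A B → Set e
    id    : ∀ {A} → Hom A A
    _∘_   : ∀ {A B C} → Hom B C → Hom A B → Hom A C
    ≈-equiv   : ∀ {A B} → IsEquivalence (_≈_ {A} {B})
    ∘-resp-≈  : ∀ {A B C} {f h : Hom B C} {g i : Hom A B} →
                f ≈ h → g ≈ i → f ∘ g ≈ h ∘ i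
    assoc     : ∀ {A B C D} {f : Hom A B} {g : Hom B C} {h : Hom C D} →
                (h ∘ g) ∘ f ≈ h ∘ (g ∘ f)
    identityˡ : ∀ {A B} {f : Hom A B} → id ∘ f ≈ f
    identityʳ : ∀ {A B} {f : Hom A B} → f ∘ id ≈ f

record Spined {o ℓ e : Level} (𝒞 : Category o ℓ e) : Set (o ⊔ ℓ ⊔ e) where
  open Category 𝒞
  field
    Ω   : ℕ → Obj
    𝔓   : ∀ {n G H} → Hom (Ω n) G → Hom (Ω n) H → Obj
    𝔓ₗ  : ∀ {n G H} (g : Hom (Ω n) G) (h : Hom (Ω n) H) → Hom G (𝔓 g h)
    𝔓ᵣ  : ∀ {n G H} (g : Hom (Ω n) G) (h : Hom (Ω n) H) → Hom H (𝔓 g h)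
    𝔓-comm : ∀ {n G H} (g : Hom (Ω n) G) (h : Hom (Ω n) H) →
             𝔓ₗ g h ∘ g ≈ 𝔓ᵣ g h ∘ h
    SC1 : ∀ (X : Obj) → Σ ℕ (λ n → Hom X (Ω n))
    SC2-map  : ∀ {n G H G′ H′} (g : Hom (Ω n) G) (h : Hom (Ω n) H)
               (g′ : Hom G G′) (h′ : Hom H H′) →
               Hom (𝔓 g h) (𝔓 (g′ ∘ g) (h′ ∘ h))
    SC2-commₗ : ∀ {n G H G′ H′} (g : Hom (Ω n) G) (h : Hom (Ω n) H)
                (g′ : Hom G G′) (h′ : Hom H H′) →
                SC2-map g h g′ h′ ∘ 𝔓ₗ g h ≈ 𝔓ₗ (g′ ∘ g) (h′ ∘ h) ∘ g′
    SC2-commᵣ : ∀ {n G H G′ H′} (g : Hom (Ω n) G) (h : Hom (Ω n) H)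
                (g′ : Hom G G′) (h′ : Hom H H′) →
                SC2-map g h g′ h′ ∘ 𝔓ᵣ g h ≈ 𝔓ᵣ (g′ ∘ g) (h′ ∘ h) ∘ h′
    SC2-unique : ∀ {n G H G′ H′} (g : Hom (Ω n) G) (h : Hom (Ω n) H)
                 (g′ : Hom G G′) (h′ : Hom H H′)
                 (u : Hom (𝔓 g h) (𝔓 (g′ ∘ g) (h′ ∘ h))) →
                 u ∘ 𝔓ₗ g h ≈ 𝔓ₗ (g′ ∘ g) (h′ ∘ h) ∘ g′ →
                 u ∘ 𝔓ᵣ g h ≈ 𝔓ᵣ (g′ ∘ g) (h′ ∘ h) ∘ h′ →
                 u ≈ SC2-map g h g′ h′

-- An S-functor: a functor into the poset (ℕ, ≤) (i.e. a monotone object map,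
-- since functoriality into a thin category is automatic).
record SFunctor {o ℓ e : Level} {𝒞 : Category o ℓ e} (S : Spined 𝒞)
       : Set (o ⊔ ℓ) where
  open Category 𝒞
  open Spined S
  field
    F₀    : Obj → ℕ
    F₁    : ∀ {X Y} → Hom X Y → F₀ X ≤ F₀ Y
    F-Ω   : ∀ n → F₀ (Ω n) ≡ n
    F-𝔓   : ∀ {n G H} (g : Hom (Ω n) G) (h : Hom (Ω n) H) →
            F₀ (𝔓 g h) ≡ max (F₀ G) (F₀ H)

PseudoChordal : ∀ {o ℓ e} {𝒞 : Category o ℓ e} (S : Spined 𝒞) →
                Category.Obj 𝒞 → Set (o ⊔ ℓ)
PseudoChordal S X = ∀ (F G : SFunctor S) → SFunctor.F₀ F X ≡ SFunctor.F₀ G X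

module Submission where

open import Defs
open import Level using (Level)
open import Data.Nat using (ℕ) renaming (_⊔_ to max)
open import Data.Product using (_×_; _,_)
open import Relation.Binary.PropositionalEquality using (cong₂; module ≡-Reasoning)

module _ {o ℓ e : Level} {𝒞 : Category o ℓ e} (S : Spined 𝒞) where
  open Category 𝒞 using (Obj; Hom)
  open Spined S using (Ω; 𝔓)
  open SFunctor
  open ≡-Reasoning

  Ω-pseudoChordal : (n : ℕ) → PseudoChordal S (Ω n)
  Ω-pseudoChordal n F G = begin
    F₀ F (Ω n)  ≡⟨ F-Ω F n ⟩
    n           ≡⟨ F-Ω G n ⟨
    F₀ G (Ω n)  ∎

  𝔓-pseudoChordal : ∀ {n} {A B : Obj} (f : Hom (Ω n) A) (g : Hom (Ω n) B) →
                    PseudoChordal S A → PseudoChordal S B → PseudoChordal S (𝔓 f g)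
  𝔓-pseudoChordal {A = A} {B} f g A-chordal B-chordal F G = begin
    F₀ F (𝔓 f g)             ≡⟨ F-𝔓 F f g ⟩
    max (F₀ F A) (F₀ F B)    ≡⟨ cong₂ max (A-chordal F G) (B-chordal F G) ⟩
    max (F₀ G A) (F₀ G B)    ≡⟨ F-𝔓 G f g ⟨
    F₀ G (𝔓 f g)             ∎

proposition4p2 : ∀ {o ℓ e : Level} (𝒞 : Category o ℓ e) (S : Spined 𝒞) →
    ((n : ℕ) → PseudoChordal S (Spined.Ω S n))
    × (∀ {n : ℕ} {A B : Category.Obj 𝒞}
         (f : Category.Hom 𝒞 (Spined.Ω S n) A) (g : Category.Hom 𝒞 (Spined.Ω S n) B) →
         PseudoChordal S A → PseudoChordal S B → PseudoChordal S (Spined.𝔓 S f g))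
proposition4p2 𝒞 S = Ω-pseudoChordal S , 𝔓-pseudoChordal S
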